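{- Let $X=\prod_{i=1}^n\{0,\dots,m_i\}$ and $f\colon X\to X$. For every $x\in X$, the graph $\mathcal{G}_f(x)$ is a subgraph (as a signed graph) of the local interaction graph $G_f(x)$.
   Context: $m_i\ge1$; $e^k$ is the $k$-th unit vector and $\mathrm{sign}(0)=0$. For $i=1,\dots,n$ define $F^i\colon X\to X$ by $F^i(x)=x+\mathrm{sign}(f_i(x)-x_i)e^i$. The graph $\mathcal{G}_f(x)$ has vertex set $\{1,\dots,n\}$ and an edge from $j$ to $i$ of sign $s$ if (i) $\mathrm{sign}(f_i(x)-x_i)\ne\mathrm{sign}(f_i(F^j(x))-F^j_i(x))$ and (ii) $s=\mathrm{sign}(f_j(x)-x_j)\,\mathrm{sign}(f_i(F^j(x))-F^j_i(x))\ne0$. The local interaction graph $G_f(x)$ has vertex set $\{1,\dots,n\}$ and an edge from $j$ to $i$ of sign $s=s_1\,\mathrm{sign}(f_i(x+s_1e^j)-f_i(x))$ whenever $s_1\in\{ -1,1\}$, $x+s_1e^j\in X$ and $s\ne0$. -}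

module Defs where

open import Data.Nat using (ℕ)
open import Data.Fin using (Fin; _≟_)
open import Data.Integer using (ℤ; +_; -[1+_]; _+_; _-_; _*_; _≤_; 0ℤ; 1ℤ; -1ℤ)
open import Data.Bool using (if_then_else_)
open import Data.Product using (_×_; ∃-syntax)
open import Data.Sum using (_⊎_)
open import Relation.Nullary using (¬_)
open import Relation.Nullary.Decidable using (⌊_⌋)
open import Relation.Binary.PropositionalEquality using (_≡_; _≢_)

Config : ℕ → Set
Config n = Fin n → ℤ

InX : {n : ℕ} → (m : Fin n → ℕ) → Config n → Set
InX m x = ∀ i → (0ℤ ≤ x i) × (x i ≤ + (m i))

sgn : ℤ → ℤ
sgn (+ 0) = 0ℤ
sgn (+ (ℕ.suc _)) = 1ℤ
sgn -[1+ _ ] = -1ℤ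

shift : {n : ℕ} → Config n → Fin n → ℤ → Config n
shift x j c k = if ⌊ j ≟ k ⌋ then x k + c else x k

F : {n : ℕ} → (Config n → Config n) → Fin n → Config n → Config n
F f j x = shift x j (sgn (f x j - x j))

AsyncEdge : {n : ℕ} → (Config n → Config n) → Config n → Fin n → Fin n → ℤ → Set
AsyncEdge f x j i s =
  (sgn (f x i - x i) ≢ sgn (f (F f j x) i - F f j x i))
  × (s ≡ sgn (f x j - x j) * sgn (f (F f j x) i - F f j x i))
  × (s ≢ 0ℤ)

LocalEdge : {n : ℕ} → (m : Fin n → ℕ) → (Config n → Config n) → Config n → Fin n → Fin n → ℤ → Set
LocalEdge m f x j i s =
  ∃[ s₁ ] ((s₁ ≡ -1ℤ ⊎ s₁ ≡ 1ℤ)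
          × InX m (shift x j s₁)
          × (s ≡ s₁ * sgn (f (shift x j s₁) i - f x i))
          × (s ≢ 0ℤ))

-- Take s₁ = sign(f_j(x) - x_j), so that x + s₁eʲ = Fʲ(x) =: y. It lies in X because it moves
-- x_j one unit towards f_j(x) ∈ {0,…,m_j}. The edge says that t = sign(f_i(y) - y_i) is
-- nonzero and differs from sign(f_i(x) - x_i); since a unit step towards f(x) never jumps
-- over f(x), f_i(x) is not strictly on the t-side of y_i either. Hence f_i(y) - f_i(x) has
-- sign t, and s = s₁ t is the sign of the local edge.
module Submission where

open import Defs
open import Data.Nat using (ℕ; _≥_)
open import Data.Fin using (Fin; _≟_)
open import Data.Integer
  using (ℤ; +_; -[1+_]; +0; +[1+_]; +<+; +≤+; -_; _+_; _-_; _*_; _≤_; _<_; 0ℤ; 1ℤ; -1ℤ)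
open import Data.Integer.Properties
  using (<-cmp; <-trans; ≤-trans; ≤-refl; +-comm; +-identityʳ; +-inverseʳ; +-monoˡ-<; *-zeroˡ; *-zeroʳ;
         i≤j⇒i-j≤0; i≤j⇒0≤j-i; i≤j⇒i-k≤j; i≤i+j; i<j⇒i≤pred[j]; i<j⇒suc[i]≤j)
open import Data.Product using (_×_; _,_; proj₁; proj₂; uncurry)
open import Data.Sum using (_⊎_; inj₁; inj₂; [_,_]′)
open import Data.Empty using (⊥-elim)
open import Relation.Binary.Definitions using (tri<; tri≈; tri>)
open import Relation.Nullary using (yes; no)
open import Relation.Binary.PropositionalEquality using (_≡_; _≢_; refl; sym; trans; cong; subst)

private
  variable
    n : ℕ
    i j : ℤ

sgn-neg : i < 0ℤ → sgn i ≡ -1ℤ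
sgn-neg { -[1+ _ ]} _ = refl
sgn-neg {+ _} (+<+ ())

sgn-pos : 0ℤ < i → sgn i ≡ 1ℤ
sgn-pos {+[1+ _ ]} _ = refl
sgn-pos {+0} (+<+ ())

sgn-nonpos : i ≤ 0ℤ → sgn i ≡ 0ℤ ⊎ sgn i ≡ -1ℤ
sgn-nonpos {+0} _ = inj₁ refl
sgn-nonpos { -[1+ _ ]} _ = inj₂ refl
sgn-nonpos {+[1+ _ ]} (+≤+ ())

sgn-nonneg : 0ℤ ≤ i → sgn i ≡ 0ℤ ⊎ sgn i ≡ 1ℤ
sgn-nonneg {+0} _ = inj₁ refl
sgn-nonneg {+[1+ _ ]} _ = inj₂ refl

sgn≢0⇒sgn≡±1 : sgn i ≢ 0ℤ → sgn i ≡ -1ℤ ⊎ sgn i ≡ 1ℤ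
sgn≢0⇒sgn≡±1 {+0} sgn≢0 = ⊥-elim (sgn≢0 refl)
sgn≢0⇒sgn≡±1 {+[1+ _ ]} _ = inj₂ refl
sgn≢0⇒sgn≡±1 { -[1+ _ ]} _ = inj₁ refl

sgn[i-i]≡0 : ∀ i → sgn (i - i) ≡ 0ℤ
sgn[i-i]≡0 i = cong sgn (+-inverseʳ i)

sgn[i-j]≡-1 : i < j → sgn (i - j) ≡ -1ℤ
sgn[i-j]≡-1 {i} {j} i<j = sgn-neg (subst (i - j <_) (+-inverseʳ j) (+-monoˡ-< (- j) i<j))

sgn[i-j]≡1 : j < i → sgn (i - j) ≡ 1ℤ
sgn[i-j]≡1 {j} {i} j<i = sgn-pos (subst (_< i - j) (+-inverseʳ j) (+-monoˡ-< (- j) j<i))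

i*j≢0⇒i≢0 : i * j ≢ 0ℤ → i ≢ 0ℤ
i*j≢0⇒i≢0 {j = j} i*j≢0 refl = i*j≢0 (*-zeroˡ j)

i*j≢0⇒j≢0 : i * j ≢ 0ℤ → j ≢ 0ℤ
i*j≢0⇒j≢0 {i} i*j≢0 refl = i*j≢0 (*-zeroʳ i)

-- b is strictly on one side of c and a is not, so c lies weakly between a and b.
sgn[b-a]≡sgn[b-c] : ∀ a b c → sgn (b - c) ≢ 0ℤ → sgn (a - c) ≢ sgn (b - c) → sgn (b - a) ≡ sgn (b - c)
sgn[b-a]≡sgn[b-c] a b c b≉c a≁b with <-cmp b c | <-cmp a c
... | tri≈ _ refl _ | _             = ⊥-elim (b≉c (sgn[i-i]≡0 b))
... | tri< b<c _ _  | tri< a<c _ _  = ⊥-elim (a≁b (trans (sgn[i-j]≡-1 a<c) (sym (sgn[i-j]≡-1 b<c))))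
... | tri< _ _ _    | tri≈ _ refl _ = refl
... | tri< b<c _ _  | tri> _ _ c<a  = trans (sgn[i-j]≡-1 (<-trans b<c c<a)) (sym (sgn[i-j]≡-1 b<c))
... | tri> _ _ c<b  | tri> _ _ c<a  = ⊥-elim (a≁b (trans (sgn[i-j]≡1 c<a) (sym (sgn[i-j]≡1 c<b))))
... | tri> _ _ _    | tri≈ _ refl _ = refl
... | tri> _ _ c<b  | tri< a<c _ _  = trans (sgn[i-j]≡1 (<-trans a<c c<b)) (sym (sgn[i-j]≡1 c<b))

stepTowards : ℤ → ℤ → ℤ
stepTowards a c = c + sgn (a - c)

step-down : i < j → i ≤ j + -1ℤ × j + -1ℤ ≤ j
step-down {i} {j} i<j = subst (i ≤_) (+-comm -1ℤ j) (i<j⇒i≤pred[j] i<j) , i≤j⇒i-k≤j 1ℤ ≤-refl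

step-up : j < i → j ≤ j + 1ℤ × j + 1ℤ ≤ i
step-up {j} {i} j<i = i≤i+j j 1ℤ , subst (_≤ i) (+-comm 1ℤ j) (i<j⇒suc[i]≤j j<i)

stepTowards-bounded : ∀ {lo hi} a c → lo ≤ a → a ≤ hi → lo ≤ c → c ≤ hi
                    → lo ≤ stepTowards a c × stepTowards a c ≤ hi
stepTowards-bounded a c lo≤a a≤hi lo≤c c≤hi with <-cmp a c
... | tri< a<c _ _ rewrite sgn[i-j]≡-1 a<c =
  ≤-trans lo≤a (proj₁ (step-down a<c)) , ≤-trans (proj₂ (step-down a<c)) c≤hi
... | tri≈ _ refl _ rewrite sgn[i-i]≡0 a | +-identityʳ a = lo≤a , a≤hi
... | tri> _ _ c<a rewrite sgn[i-j]≡1 c<a =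
  ≤-trans lo≤c (proj₁ (step-up c<a)) , ≤-trans (proj₂ (step-up c<a)) a≤hi

sgn-stepTowards : ∀ a c → sgn (a - stepTowards a c) ≡ 0ℤ ⊎ sgn (a - stepTowards a c) ≡ sgn (a - c)
sgn-stepTowards a c with <-cmp a c
... | tri< a<c _ _ rewrite sgn[i-j]≡-1 a<c = sgn-nonpos (i≤j⇒i-j≤0 (proj₁ (step-down a<c)))
... | tri≈ _ refl _ rewrite sgn[i-i]≡0 a | +-identityʳ a = inj₁ (sgn[i-i]≡0 a)
... | tri> _ _ c<a rewrite sgn[i-j]≡1 c<a = sgn-nonneg (i≤j⇒0≤j-i (proj₂ (step-up c<a)))

shift-preserves-InX : ∀ {m : Fin n → ℕ} {x} k c → InX m x → 0ℤ ≤ x k + c → x k + c ≤ + m k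
                    → InX m (shift x k c)
shift-preserves-InX k c x∈X lo hi l with k ≟ l
... | yes refl = lo , hi
... | no _     = x∈X l

F-preserves-InX : ∀ {m : Fin n → ℕ} (f : Config n → Config n) → (∀ x → InX m x → InX m (f x))
                → ∀ {x} k → InX m x → InX m (F f k x)
F-preserves-InX f f∈X {x} k x∈X =
  uncurry (shift-preserves-InX k _ x∈X)
          (stepTowards-bounded (f x k) (x k) (proj₁ (f∈X x x∈X k)) (proj₂ (f∈X x x∈X k))
                               (proj₁ (x∈X k)) (proj₂ (x∈X k)))

F-preserves-sgn≢ : ∀ (f : Config n → Config n) x k l {τ} → τ ≢ 0ℤ
                 → sgn (f x l - x l) ≢ τ → sgn (f x l - F f k x l) ≢ τ
F-preserves-sgn≢ f x k l {τ} τ≢0 sgn≢τ with k ≟ l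
... | no _     = sgn≢τ
... | yes refl = [ (λ ≡0 ≡τ → τ≢0 (trans (sym ≡τ) ≡0)) , (λ ≡d ≡τ → sgn≢τ (trans (sym ≡d) ≡τ)) ]′
                 (sgn-stepTowards (f x k) (x k))

lemma7 : (n : ℕ) (m : Fin n → ℕ) → (∀ i → m i ≥ 1)
    → (f : Config n → Config n) → (∀ x → InX m x → InX m (f x))
    → (x : Config n) → InX m x
    → (j i : Fin n) (s : ℤ) → AsyncEdge f x j i s → LocalEdge m f x j i s
lemma7 n m _ f f∈X x x∈X j i s (sgn-changes , s≡d*t , s≢0) =
  d , sgn≢0⇒sgn≡±1 d≢0 , F-preserves-InX f f∈X j x∈X , trans s≡d*t (cong (d *_) (sym local-sign)) , s≢0
  where
  y : Config n
  y = F f j x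
  d t : ℤ
  d = sgn (f x j - x j)
  t = sgn (f y i - y i)
  d*t≢0 : d * t ≢ 0ℤ
  d*t≢0 = subst (_≢ 0ℤ) s≡d*t s≢0
  d≢0 : d ≢ 0ℤ
  d≢0 = i*j≢0⇒i≢0 d*t≢0
  t≢0 : t ≢ 0ℤ
  t≢0 = i*j≢0⇒j≢0 {d} d*t≢0
  local-sign : sgn (f y i - f x i) ≡ t
  local-sign = sgn[b-a]≡sgn[b-c] (f x i) (f y i) (y i) t≢0 (F-preserves-sgn≢ f x j i t≢0 sgn-changes)
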